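{- Consider the Non-Linear Knapsack-Cover problem in the list model and let $\bar v,\bar z$ be the dual and primal solutions output by Algorithm 1 (both defined in the context). Then for every $(a,F)\in\mathcal F$ with $\bar v_{aF}>0$, \[\sum_{i\in N}\sum_{j=a_i+1}^{m}\tau(i,j,a,F)\,\bar z_{ij}\le 2D(a).\]
   Context: Non-Linear Knapsack-Cover problem: given a finite set $N$ of $n$ items, a demand $D\in\mathbb{N}$, an integer $m\le D$, and for each $i\in N$ a non-decreasing function $f_i:\{0,1,\dots,m\}\to\mathbb{Q}_{\ge0}\cup\{\infty\}$, choose $x\in\{0,\dots,m\}^N$ with $\sum_{i}x_i\ge D$ minimizing $\sum_i f_i(x_i)$; the instance is assumed feasible; in the list model all values $f_i(0),\dots,f_i(m)$ are given. Let $M=\{1,\dots,m\}$ and $g_{ij}=f_i(j)-f_i(j-1)$. For $a\in\{0,\dots,m\}^N$ let $D(a)=\max\{D-\sum_{i}a_i,0\}$ and $m_i(a)=\min\{m,a_i+D(a)\}$. $\mathcal F$ is the set of pairs $(a,F)$ with $a\in\{0,\dots,m\}^N$ and $F=(F_i^k)_{i\in N,k\in\{0,\dots,m-1\}}$ such that for each $i$ the sets $F_i^0,\dots,F_i^{m-1}$ are pairwise disjoint with union $\{a_i+1,\dots,m\}$ and $j\in F_i^k\Rightarrow j-k\ge1$. Define $\tau(i,j,a,F)=|\{\ell\ge j:\ \ell\in F_i^{\ell-j},\ \ell\le m_i(a)\}|$. Dual LP [D-GKC]: maximize $\sum_{(a,F)\in\mathcal F}D(a)v_{aF}$ s.t.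 $\sum_{(a,F)\in\mathcal F:\,a_i<j}\tau(i,j,a,F)v_{aF}\le g_{ij}$ for all $i\in N,j\in M$, $v\ge0$. Algorithm 1: call $(i,j)$ full when the dual constraint indexed by $(i,j)$ is tight for the current $v$. Initialize $v=0$, $z=0$, $a=0$, $F_i^0=M$, $F_i^k=\emptyset$ for $k\ge1$. While $D(a)>0$: continuously increase $v_{aF}$ for the current $(a,F)$ (each $F_i^k$ intersected with $\{a_i+1,\dots,m\}$) until some dual constraint $(i,j)$ becomes tight (pick one if several). If $j=a_i+1$: let $q>a_i$ be maximal with $(i,a_i+1),\dots,(i,q)$ all full; set $z_{i\ell}=1$ for $\ell=j,\dots,q$ and $a_i\leftarrow q$. Otherwise: let $p<j$ be maximal with $(i,p)$ not full and $q>j$ minimal with $(i,q)$ not full ($q=m+1$ if none); for $\ell=j,\dots,q-1$ move $\ell$ from $F_i^{\ell-j}$ to $F_i^{\ell-p}$. When $D(a)=0$ output $v,z$. -}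

module Defs where

open import Data.Bool using (Bool; true; false; if_then_else_; _∧_)
open import Data.Nat as ℕ using (ℕ; zero; suc; _∸_; _⊔_; _⊓_; _≤ᵇ_; _<ᵇ_; _≡ᵇ_)
open import Data.Fin using (Fin)
import Data.Fin as Fin
open import Data.Integer using (+_)
open import Data.Rational as ℚ using (ℚ; 0ℚ; _/_)
open import Data.Nat.ListAction using (sum)
open import Data.List using (List; []; _∷_; map; length; filterᵇ; applyUpTo; allFin)
open import Data.List.Membership.Propositional using (_∈_)
open import Data.Product using (Σ; _×_; _,_; ∃)
open import Data.Sum using (_⊎_)
open import Relation.Binary.PropositionalEquality using (_≡_)
open import Relation.Nullary using (¬_; does)

data ℚ∞ : Set where
  fin : ℚ → ℚ∞
  ∞   : ℚ∞

data _≤∞_ : ℚ∞ → ℚ∞ → Set where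
  fin≤fin : ∀ {x y} → x ℚ.≤ y → fin x ≤∞ fin y
  _≤∞∞    : ∀ (x : ℚ∞) → x ≤∞ ∞

sumFin : ∀ {n} → (Fin n → ℕ) → ℕ
sumFin {n} h = sum (map h (allFin n))

-- the list [lo, lo+1, ..., hi]  (empty if hi < lo)
interval : ℕ → ℕ → List ℕ
interval lo hi = applyUpTo (ℕ._+_ lo) (suc hi ∸ lo)

sumRange : ℕ → ℕ → (ℕ → ℕ) → ℕ
sumRange lo hi h = sum (map h (interval lo hi))

ℕtoℚ : ℕ → ℚ
ℕtoℚ k = + k / 1

-- An instance of Non-Linear Knapsack-Cover (list model: all values
-- f_i(0..m) are given, here as the function f restricted to 0..m).
-- Items N = Fin n.  Values f i j for j > m are irrelevant.

record Instance : Set where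
  field
    n     : ℕ
    D     : ℕ
    m     : ℕ
    m≤D   : m ℕ.≤ D
    f     : Fin n → ℕ → ℚ∞
    f-nonneg   : ∀ i j x → j ℕ.≤ m → f i j ≡ fin x → 0ℚ ℚ.≤ x
    f-monotone : ∀ i j → j ℕ.< m → f i j ≤∞ f i (suc j)
    feasible : Σ (Fin n → ℕ) λ x →
                 (∀ i → x i ℕ.≤ m) × (D ℕ.≤ sumFin x) ×
                 (∀ i → ∃ λ c → f i (x i) ≡ fin c)

module _ (I : Instance) where
  open Instance I

  -- g_ij = f_i(j) - f_i(j-1); convention: ∞ whenever f_i(j) = ∞
  -- (and also when f_i(j-1) = ∞, which by monotonicity forces f_i(j) = ∞)
  g : Fin n → ℕ → ℚ∞
  g i j with f i j | f i (j ∸ 1)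
  ... | fin x | fin y = fin (x ℚ.- y)
  ... | _     | _     = ∞

  Dres : (Fin n → ℕ) → ℕ
  Dres a = D ∸ sumFin a

  mi : (Fin n → ℕ) → Fin n → ℕ
  mi a i = m ⊓ (a i ℕ.+ Dres a)

  -- The family F = (F_i^k) is represented by its "index function":
  -- for ℓ ∈ {a_i+1,...,m},  ℓ ∈ F_i^k  iff  F i ℓ ≡ k.
  -- (This encodes exactly the pairwise disjointness and the union
  -- condition; values outside {a_i+1..m} are ignored.)

  τ : Fin n → ℕ → (Fin n → ℕ) → (Fin n → ℕ → ℕ) → ℕ
  τ i j a F = length (filterᵇ (λ ℓ → (a i <ᵇ ℓ) ∧ (F i ℓ ≡ᵇ (ℓ ∸ j)))
                              (interval j (mi a i)))

  record State : Set where
    constructor ⟨_,_,_,_⟩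
    field
      a    : Fin n → ℕ
      F    : Fin n → ℕ → ℕ
      load : Fin n → ℕ → ℚ      -- LHS of dual constraint (i,j) for the current v
      z    : Fin n → ℕ → ℕ
  open State public

  initState : State
  initState = ⟨ (λ _ → 0) , (λ _ _ → 0) , (λ _ _ → 0ℚ) , (λ _ _ → 0) ⟩

  -- dual constraint (i,j) left-hand side after increasing v_{aF} by δ
  newLoad : State → ℚ → Fin n → ℕ → ℚ
  newLoad s δ i j =
    if a s i <ᵇ j then load s i j ℚ.+ (ℕtoℚ (τ i j (a s) (F s)) ℚ.* δ)
                  else load s i j

  Full : (Fin n → ℕ → ℚ) → Fin n → ℕ → Set
  Full L i j = g i j ≡ fin (L i j)

  _==_ : Fin n → Fin n → Bool
  i == i' = does (i Fin.≟ i')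

  -- one iteration of the while loop: from s, increase v_{a(s)F(s)} by δ,
  -- constraint (i,j) becomes tight, leading to state s'
  data Step (s : State) (δ : ℚ) : State → Set where
    absorb : ∀ i j q →
      0ℚ ℚ.≤ δ →
      ℕ._≤_ 1 j → j ℕ.≤ m →
      a s i ℕ.< j →
      0 ℕ.< τ i j (a s) (F s) →
      (∀ i' j' → 1 ℕ.≤ j' → j' ℕ.≤ m → fin (newLoad s δ i' j') ≤∞ g i' j') →
      Full (newLoad s δ) i j →
      j ≡ suc (a s i) →
      j ℕ.≤ q → q ℕ.≤ m →
      (∀ ℓ → j ℕ.≤ ℓ → ℓ ℕ.≤ q → Full (newLoad s δ) i ℓ) →
      (q ≡ m ⊎ (q ℕ.< m × ¬ Full (newLoad s δ) i (suc q))) →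
      Step s δ ⟨ (λ i' → if i' == i then q else a s i')
               , F s
               , newLoad s δ
               , (λ i' ℓ → if (i' == i) ∧ ((j ≤ᵇ ℓ) ∧ (ℓ ≤ᵇ q)) then 1 else z s i' ℓ) ⟩
    shift : ∀ i j p q →
      0ℚ ℚ.≤ δ →
      ℕ._≤_ 1 j → j ℕ.≤ m →
      a s i ℕ.< j →
      0 ℕ.< τ i j (a s) (F s) →
      (∀ i' j' → 1 ℕ.≤ j' → j' ℕ.≤ m → fin (newLoad s δ i' j') ≤∞ g i' j') →
      Full (newLoad s δ) i j →
      ¬ (j ≡ suc (a s i)) →
      ℕ._≤_ 1 p → p ℕ.< j → ¬ Full (newLoad s δ) i p →
      (∀ ℓ → p ℕ.< ℓ → ℓ ℕ.< j → Full (newLoad s δ) i ℓ) →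
      -- q > j minimal with (i,q) not full (q = m+1 if none)
      j ℕ.< q → q ℕ.≤ suc m →
      (∀ ℓ → j ℕ.< ℓ → ℓ ℕ.< q → Full (newLoad s δ) i ℓ) →
      (q ≡ suc m ⊎ (q ℕ.≤ m × ¬ Full (newLoad s δ) i q)) →
      Step s δ ⟨ a s
               , (λ i' ℓ → if (i' == i) ∧ ((j ≤ᵇ ℓ) ∧ (ℓ <ᵇ q)) then ℓ ∸ p else F s i' ℓ)
               , newLoad s δ
               , z s ⟩

  -- A complete execution of Algorithm 1 from state s to final state s_f,
  -- recording for every iteration the pair (state, δ) where δ is the
  -- amount by which v_{a(state)F(state)} was increased in that iteration.
  data Exec (s : State) : State → List (State × ℚ) → Set where
    done : Dres (a s) ≡ 0 → Exec s s []
    step : ∀ {δ s' sf hist} → 0 ℕ.< Dres (a s) → Step s δ s' →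
           Exec s' sf hist → Exec s sf ((s , δ) ∷ hist)

module Submission where

-- Fix an iteration with current (a, F) and let z̄ be the final primal solution.
-- For an item i, Σ_j τ(i,j,a,F) z̄_ij counts the ℓ ∈ (a_i, m_i(a)] whose unique
-- j = ℓ - k (where ℓ ∈ F_i^k) has z̄_ij = 1. The invariant "ℓ ∈ F_i^k keeps the
-- constraints (i, ℓ-k+1), …, (i, ℓ) tight" together with the monotonicity of
-- tightness shows that every counted ℓ is at most the final ā_i: otherwise
-- (i, ā_i + 1) would already be tight, but the absorb step that fixed ā_i stopped
-- right below a non-tight constraint. So item i contributes at most
-- min(ā_i - a_i, D(a)). Only one coordinate of a changes in the last iteration,
-- whose start a′ still has Σ a′ < D; hence the unchanged items contribute at most
-- Σ_i (a′_i - a_i) ≤ D(a) in total and the changed one at most D(a).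

open import Defs

module FiniteSums where
  open import Data.Bool using (Bool; true; false; if_then_else_)
  open import Data.Bool.Properties using (T-≡)
  open import Data.Empty using (⊥-elim)
  open import Data.Fin using (Fin) renaming (zero to fzero; suc to fsuc)
  open import Data.Fin.Properties using () renaming (suc-injective to fsuc-injective)
  open import Data.List using ([]; _∷_; map; length; filterᵇ; applyUpTo; allFin)
  open import Data.List.Properties using (map-cong; map-tabulate; map-applyUpTo)
  open import Data.Nat
  open import Data.Nat.ListAction using (sum)
  open import Data.Nat.Properties
  open import Algebra.Properties.CommutativeSemigroup +-commutativeSemigroup using (interchange)
  open import Data.Product using (_×_; _,_; proj₁; proj₂)
  open import Function using (_∘_; Equivalence)
  open import Relation.Binary.PropositionalEquality
  open import Relation.Nullary using (¬_; yes; no)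
  open Equivalence using (to; from)

  Σ< : ℕ → (ℕ → ℕ) → ℕ
  Σ< zero    h = 0
  Σ< (suc k) h = Σ< k h + h k

  Σ<-cong : ∀ {h h′} k → (∀ t → t < k → h t ≡ h′ t) → Σ< k h ≡ Σ< k h′
  Σ<-cong zero    e = refl
  Σ<-cong (suc k) e = cong₂ _+_ (Σ<-cong k (λ t t<k → e t (m<n⇒m<1+n t<k))) (e k ≤-refl)

  Σ<-mono-≤ : ∀ {h h′} k → (∀ t → t < k → h t ≤ h′ t) → Σ< k h ≤ Σ< k h′
  Σ<-mono-≤ zero    le = z≤n
  Σ<-mono-≤ (suc k) le = +-mono-≤ (Σ<-mono-≤ k (λ t t<k → le t (m<n⇒m<1+n t<k))) (le k ≤-refl)

  Σ<-zero : ∀ k → Σ< k (λ _ → 0) ≡ 0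
  Σ<-zero zero    = refl
  Σ<-zero (suc k) = trans (+-identityʳ _) (Σ<-zero k)

  Σ<-+ : ∀ h h′ k → Σ< k (λ t → h t + h′ t) ≡ Σ< k h + Σ< k h′
  Σ<-+ h h′ zero    = refl
  Σ<-+ h h′ (suc k) = trans (cong (_+ (h k + h′ k)) (Σ<-+ h h′ k))
                            (interchange (Σ< k h) (Σ< k h′) (h k) (h′ k))

  Σ<-*ʳ : ∀ h w k → Σ< k h * w ≡ Σ< k (λ t → h t * w)
  Σ<-*ʳ h w zero    = refl
  Σ<-*ʳ h w (suc k) = trans (*-distribʳ-+ w (Σ< k h) (h k)) (cong (_+ h k * w) (Σ<-*ʳ h w k))

  Σ<-swap : ∀ (c : ℕ → ℕ → ℕ) J K →
            Σ< J (λ j → Σ< K (c j)) ≡ Σ< K (λ l → Σ< J (λ j → c j l))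
  Σ<-swap c zero    K = sym (Σ<-zero K)
  Σ<-swap c (suc J) K = trans (cong (_+ Σ< K (c J)) (Σ<-swap c J K))
                              (sym (Σ<-+ (λ l → Σ< J (λ j → c j l)) (c J) K))

  Σ<-suc : ∀ h k → Σ< (suc k) h ≡ h 0 + Σ< k (h ∘ suc)
  Σ<-suc h zero    = +-comm 0 (h 0)
  Σ<-suc h (suc k) = trans (cong (_+ h (suc k)) (Σ<-suc h k)) (+-assoc (h 0) _ _)

  sum-applyUpTo : ∀ h k → sum (applyUpTo h k) ≡ Σ< k h
  sum-applyUpTo h zero    = refl
  sum-applyUpTo h (suc k) = trans (cong (h 0 +_) (sum-applyUpTo (h ∘ suc) k)) (sym (Σ<-suc h k))

  <⇒≤ᵇ≡false : ∀ {m n} → n < m → (m ≤ᵇ n) ≡ false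
  <⇒≤ᵇ≡false {m} {n} n<m with m ≤ᵇ n in eq
  ... | true  = ⊥-elim (<⇒≱ n<m (≤ᵇ⇒≤ m n (from T-≡ eq)))
  ... | false = refl

  startAt : ℕ → (ℕ → ℕ) → ℕ → ℕ
  startAt lo h t = if lo ≤ᵇ t then h t else 0

  startAt-≥ : ∀ {lo t} h → lo ≤ t → startAt lo h t ≡ h t
  startAt-≥ h lo≤t rewrite to T-≡ (≤⇒≤ᵇ lo≤t) = refl

  startAt-< : ∀ {lo t} h → t < lo → startAt lo h t ≡ 0
  startAt-< h t<lo rewrite <⇒≤ᵇ≡false t<lo = refl

  startAt-pos : ∀ lo h t → 0 < startAt lo h t → lo ≤ t × 0 < h t
  startAt-pos lo h t pos with lo ≤ᵇ t in eq
  ... | true  = ≤ᵇ⇒≤ lo t (from T-≡ eq) , pos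
  ... | false = ⊥-elim (n≮0 pos)

  startAt-≤ : ∀ lo h t → startAt lo h t ≤ h t
  startAt-≤ lo h t with lo ≤ᵇ t
  ... | true  = ≤-refl
  ... | false = z≤n

  startAt-Σ< : ∀ lo (c : ℕ → ℕ → ℕ) K j →
               startAt lo (λ j → Σ< K (c j)) j ≡ Σ< K (λ l → startAt lo (λ j → c j l) j)
  startAt-Σ< lo c K j with lo ≤ᵇ j
  ... | true  = refl
  ... | false = sym (Σ<-zero K)

  Σ<-startAt-≤ : ∀ {lo k} h → k ≤ lo → Σ< k (startAt lo h) ≡ 0
  Σ<-startAt-≤ {k = k} h k≤lo =
    trans (Σ<-cong k (λ t t<k → startAt-< h (<-≤-trans t<k k≤lo))) (Σ<-zero k)

  Σ<-shift : ∀ lo h k → Σ< k (h ∘ (lo +_)) ≡ Σ< (lo + k) (startAt lo h)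
  Σ<-shift lo h zero    = sym (Σ<-startAt-≤ h (≤-reflexive (+-identityʳ lo)))
  Σ<-shift lo h (suc k) rewrite +-suc lo k =
    cong₂ _+_ (Σ<-shift lo h k) (sym (startAt-≥ h (m≤m+n lo k)))

  sumRange-Σ< : ∀ lo hi h → sumRange lo hi h ≡ Σ< (suc hi) (startAt lo h)
  sumRange-Σ< lo hi h with lo ≤? suc hi
  ... | yes lo≤ = begin
    sum (map h (applyUpTo (lo +_) (suc hi ∸ lo)))   ≡⟨ cong sum (map-applyUpTo (lo +_) h (suc hi ∸ lo)) ⟩
    sum (applyUpTo (h ∘ (lo +_)) (suc hi ∸ lo))      ≡⟨ sum-applyUpTo (h ∘ (lo +_)) (suc hi ∸ lo) ⟩
    Σ< (suc hi ∸ lo) (h ∘ (lo +_))                   ≡⟨ Σ<-shift lo h (suc hi ∸ lo) ⟩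
    Σ< (lo + (suc hi ∸ lo)) (startAt lo h)           ≡⟨ cong (λ k → Σ< k (startAt lo h)) (m+[n∸m]≡n lo≤) ⟩
    Σ< (suc hi) (startAt lo h)                       ∎
    where open ≡-Reasoning
  ... | no lo≰ rewrite m≤n⇒m∸n≡0 (<⇒≤ (≰⇒> lo≰)) = sym (Σ<-startAt-≤ h (<⇒≤ (≰⇒> lo≰)))

  length-filterᵇ : ∀ {A : Set} (p : A → Bool) xs →
                   length (filterᵇ p xs) ≡ sum (map (λ x → if p x then 1 else 0) xs)
  length-filterᵇ p []       = refl
  length-filterᵇ p (x ∷ xs) with p x
  ... | true  = cong suc (length-filterᵇ p xs)
  ... | false = length-filterᵇ p xs

  Σ<-≤-single : ∀ {h w} p k → (∀ t → h t ≤ w) → (∀ t → 0 < h t → t ≡ p) → Σ< k h ≤ w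
  Σ<-≤-single {h} {w} p k h≤w supp = go k
    where
    vanish : ∀ k → k ≤ p → Σ< k h ≡ 0
    vanish zero    _   = refl
    vanish (suc k) k<p with h k in eq
    ... | zero  = trans (+-identityʳ _) (vanish k (<⇒≤ k<p))
    ... | suc _ = ⊥-elim (<-irrefl (supp k (subst (0 <_) (sym eq) z<s)) k<p)
    go : ∀ k → Σ< k h ≤ w
    go zero    = z≤n
    go (suc k) with h k in eq
    ... | zero  = subst (_≤ w) (sym (+-identityʳ _)) (go k)
    ... | suc _ with supp k (subst (0 <_) (sym eq) z<s)
    ...   | refl rewrite vanish k ≤-refl = subst (_≤ w) eq (h≤w k)

  Σ<-≤-∸ : ∀ {h lo} k → (∀ t → h t ≤ 1) → (∀ t → 0 < h t → lo ≤ t) → Σ< k h ≤ k ∸ lo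
  Σ<-≤-∸ zero    h≤1 supp = z≤n
  Σ<-≤-∸ {h} {lo} (suc k) h≤1 supp with h k | h≤1 k | supp k
  ... | zero  | _       | _   = ≤-trans (≤-reflexive (+-identityʳ _))
                                  (≤-trans (Σ<-≤-∸ k h≤1 supp) (∸-monoˡ-≤ lo (n≤1+n k)))
  ... | suc zero | _    | lo≤ = ≤-trans (+-monoˡ-≤ 1 (Σ<-≤-∸ k h≤1 supp))
                                  (≤-reflexive (trans (+-comm _ 1) (sym (+-∸-assoc 1 (lo≤ z<s)))))
  ... | suc (suc _) | s≤s () | _

  Σ<-≤-range : ∀ {h lo hi} k → (∀ t → h t ≤ 1) → (∀ t → 0 < h t → lo ≤ t × t ≤ hi) →
               Σ< k h ≤ suc hi ∸ lo
  Σ<-≤-range zero    h≤1 supp = z≤n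
  Σ<-≤-range {h} {lo} {hi} (suc k) h≤1 supp with h k | h≤1 k | supp k
  ... | zero  | _ | _ = ≤-trans (≤-reflexive (+-identityʳ _)) (Σ<-≤-range k h≤1 supp)
  ... | suc zero | _ | range = ≤-trans (+-monoˡ-≤ 1 (Σ<-≤-∸ k h≤1 (λ t pos → proj₁ (supp t pos))))
                                 (≤-trans (≤-reflexive (trans (+-comm _ 1) (sym (+-∸-assoc 1 (proj₁ (range z<s))))))
                                   (∸-monoˡ-≤ lo (s≤s (proj₂ (range z<s)))))
  ... | suc (suc _) | s≤s () | _

  sumFin-suc : ∀ {n} (h : Fin (suc n) → ℕ) → sumFin h ≡ h fzero + sumFin (h ∘ fsuc)
  sumFin-suc {n} h = cong (h fzero +_)
    (trans (cong sum (map-tabulate fsuc h)) (sym (cong sum (map-tabulate (λ i → i) (h ∘ fsuc)))))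

  sumFin-cong : ∀ {n} {f g : Fin n → ℕ} → (∀ i → f i ≡ g i) → sumFin f ≡ sumFin g
  sumFin-cong {n} f≗g = cong sum (map-cong f≗g (allFin n))

  sumFin-+ : ∀ {n} (f g : Fin n → ℕ) → sumFin (λ i → f i + g i) ≡ sumFin f + sumFin g
  sumFin-+ {zero}  f g = refl
  sumFin-+ {suc n} f g = begin
    sumFin (λ i → f i + g i)
      ≡⟨ sumFin-suc (λ i → f i + g i) ⟩
    (f fzero + g fzero) + sumFin (λ i → f (fsuc i) + g (fsuc i))
      ≡⟨ cong (f fzero + g fzero +_) (sumFin-+ (f ∘ fsuc) (g ∘ fsuc)) ⟩
    (f fzero + g fzero) + (sumFin (f ∘ fsuc) + sumFin (g ∘ fsuc))
      ≡⟨ interchange (f fzero) (g fzero) _ _ ⟩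
    (f fzero + sumFin (f ∘ fsuc)) + (g fzero + sumFin (g ∘ fsuc))
      ≡⟨ cong₂ _+_ (sumFin-suc f) (sumFin-suc g) ⟨
    sumFin f + sumFin g
      ∎
    where open ≡-Reasoning

  sumFin-∸ : ∀ {n} (f g : Fin n → ℕ) → (∀ i → f i ≤ g i) →
             sumFin (λ i → g i ∸ f i) ≡ sumFin g ∸ sumFin f
  sumFin-∸ f g f≤g = begin
    sumFin (λ i → g i ∸ f i)                        ≡⟨ m+n∸n≡m _ (sumFin f) ⟨
    sumFin (λ i → g i ∸ f i) + sumFin f ∸ sumFin f  ≡⟨ cong (_∸ sumFin f) (sumFin-+ (λ i → g i ∸ f i) f) ⟨
    sumFin (λ i → g i ∸ f i + f i) ∸ sumFin f       ≡⟨ cong (_∸ sumFin f) (sumFin-cong (λ i → m∸n+n≡m (f≤g i))) ⟩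
    sumFin g ∸ sumFin f                             ∎
    where open ≡-Reasoning

  sumFin-mono-≤ : ∀ {n} {f g : Fin n → ℕ} → (∀ i → f i ≤ g i) → sumFin f ≤ sumFin g
  sumFin-mono-≤ {zero}          f≤g = z≤n
  sumFin-mono-≤ {suc n} {f} {g} f≤g = begin
    sumFin f                      ≡⟨ sumFin-suc f ⟩
    f fzero + sumFin (f ∘ fsuc)   ≤⟨ +-mono-≤ (f≤g fzero) (sumFin-mono-≤ (f≤g ∘ fsuc)) ⟩
    g fzero + sumFin (g ∘ fsuc)   ≡⟨ sumFin-suc g ⟨
    sumFin g                      ∎
    where open ≤-Reasoning

  sumFin-≤-except : ∀ {n} (h u : Fin n → ℕ) k → (∀ i → ¬ i ≡ k → h i ≤ u i) →
                    sumFin h ≤ sumFin u + h k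
  sumFin-≤-except h u fzero h≤u = begin
    sumFin h                                 ≡⟨ sumFin-suc h ⟩
    h fzero + sumFin (h ∘ fsuc)              ≤⟨ +-monoʳ-≤ (h fzero) (sumFin-mono-≤ (λ i → h≤u (fsuc i) λ ())) ⟩
    h fzero + sumFin (u ∘ fsuc)              ≤⟨ +-monoʳ-≤ (h fzero) (m≤n+m (sumFin (u ∘ fsuc)) (u fzero)) ⟩
    h fzero + (u fzero + sumFin (u ∘ fsuc))  ≡⟨ +-comm (h fzero) _ ⟩
    (u fzero + sumFin (u ∘ fsuc)) + h fzero  ≡⟨ cong (_+ h fzero) (sumFin-suc u) ⟨
    sumFin u + h fzero                       ∎
    where open ≤-Reasoning
  sumFin-≤-except h u (fsuc k) h≤u = begin
    sumFin h                                    ≡⟨ sumFin-suc h ⟩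
    h fzero + sumFin (h ∘ fsuc)                 ≤⟨ +-mono-≤ (h≤u fzero λ ()) rest ⟩
    u fzero + (sumFin (u ∘ fsuc) + h (fsuc k))  ≡⟨ +-assoc (u fzero) _ _ ⟨
    u fzero + sumFin (u ∘ fsuc) + h (fsuc k)    ≡⟨ cong (_+ h (fsuc k)) (sumFin-suc u) ⟨
    sumFin u + h (fsuc k)                       ∎
    where
    open ≤-Reasoning
    rest : sumFin (h ∘ fsuc) ≤ sumFin (u ∘ fsuc) + h (fsuc k)
    rest = sumFin-≤-except (h ∘ fsuc) (u ∘ fsuc) k (λ i i≢k → h≤u (fsuc i) (i≢k ∘ fsuc-injective))


module Algorithm1 (I : Instance) where
  open import Data.Bool using (true; false; if_then_else_; _∧_; T)
  open import Data.Bool.Properties using (T-≡; T-∧; ∧-zeroʳ)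
  open import Data.Empty using (⊥-elim)
  open import Data.Fin as Fin using (Fin)
  open import Data.List using (_∷_)
  open import Data.List.Membership.Propositional using (_∈_)
  open import Data.List.Relation.Unary.Any using (here; there)
  open import Data.Nat
  open import Data.Nat.Properties
  open import Data.Product using (Σ; _×_; _,_; proj₁; proj₂)
  open import Data.Rational as ℚ using (ℚ; 0ℚ)
  import Data.Rational.Properties as ℚP
  open import Data.Sum using ([_,_]′)
  open import Function using (Equivalence)
  open import Relation.Binary.Definitions using (tri<; tri≈; tri>)
  open import Relation.Binary.PropositionalEquality
  open import Relation.Nullary using (¬_; does; yes; no)
  open FiniteSums
  open Equivalence using (to; from)
  open Instance I

  *-pos : ∀ x y → 0 < x * y → 0 < x × 0 < y
  *-pos zero    y       ()
  *-pos (suc x) zero    x*0>0 rewrite *-zeroʳ x = ⊥-elim (n≮0 x*0>0)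
  *-pos (suc x) (suc y) _     = z<s , z<s

  if-≤-1 : ∀ b {x} → x ≤ 1 → (if b then 1 else x) ≤ 1
  if-≤-1 true  _   = ≤-refl
  if-≤-1 false x≤1 = x≤1

  if-pos : ∀ b → 0 < (if b then 1 else 0) → T b
  if-pos true  _ = _

  ≤-when-pos : ∀ {x y} → (0 < x → x ≤ y) → x ≤ y
  ≤-when-pos {zero}  _ = z≤n
  ≤-when-pos {suc x} f = f z<s

  ℕtoℚ*-nonNeg : ∀ k {δ} → 0ℚ ℚ.≤ δ → 0ℚ ℚ.≤ ℕtoℚ k ℚ.* δ
  ℕtoℚ*-nonNeg k {δ} δ≥0 = ℚP.nonNegative⁻¹ (ℕtoℚ k ℚ.* δ)
    {{ℚP.nonNeg*nonNeg⇒nonNeg (ℕtoℚ k) {{ℚP.normalize-nonNeg k 1}} δ {{ℚ.nonNegative δ≥0}}}}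

  ≤-if-+ : ∀ b {L x} → 0ℚ ℚ.≤ x → L ℚ.≤ (if b then L ℚ.+ x else L)
  ≤-if-+ true  {L} {x} x≥0 = subst (ℚ._≤ L ℚ.+ x) (ℚP.+-identityʳ L) (ℚP.+-monoʳ-≤ L x≥0)
  ≤-if-+ false         _   = ℚP.≤-refl

  tight-stays-tight : ∀ {G L L′} → G ≡ fin L → L ℚ.≤ L′ → fin L′ ≤∞ G → G ≡ fin L′
  tight-stays-tight refl L≤L′ (fin≤fin L′≤L) = cong fin (ℚP.≤-antisym L≤L′ L′≤L)

  update-elim : ∀ {n} (P : Fin n → ℕ → Set) (b : Fin n → ℕ) k q → P k q → (∀ i → ¬ i ≡ k → P i (b i)) →
                ∀ i → P i (if does (i Fin.≟ k) then q else b i)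
  update-elim P b k q Pk Pb i with i Fin.≟ k
  ... | yes refl = Pk
  ... | no  i≢k  = Pb i i≢k

  absorb-z-above-a : ∀ {n} (a₀ : Fin n → ℕ) (z₀ : Fin n → ℕ → ℕ) k j q →
                     (∀ i ℓ → a₀ i < ℓ → z₀ i ℓ ≡ 0) → a₀ k < j → j ≤ q →
                     ∀ i ℓ → (if does (i Fin.≟ k) then q else a₀ i) < ℓ →
                     (if does (i Fin.≟ k) ∧ ((j ≤ᵇ ℓ) ∧ (ℓ ≤ᵇ q)) then 1 else z₀ i ℓ) ≡ 0
  absorb-z-above-a a₀ z₀ k j q z₀-above a₀<j j≤q i ℓ with i Fin.≟ k
  ... | no  _    = z₀-above i ℓ
  ... | yes refl = λ q<ℓ → begin
    (if (j ≤ᵇ ℓ) ∧ (ℓ ≤ᵇ q) then 1 else z₀ i ℓ)  ≡⟨ cong (λ b → if (j ≤ᵇ ℓ) ∧ b then 1 else z₀ i ℓ) (<⇒≤ᵇ≡false q<ℓ) ⟩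
    (if (j ≤ᵇ ℓ) ∧ false then 1 else z₀ i ℓ)     ≡⟨ cong (λ b → if b then 1 else z₀ i ℓ) (∧-zeroʳ (j ≤ᵇ ℓ)) ⟩
    z₀ i ℓ                                       ≡⟨ z₀-above i ℓ (<-trans (<-≤-trans a₀<j j≤q) q<ℓ) ⟩
    0                                            ∎
    where open ≡-Reasoning

  shift-tight : ∀ {n} (Tight : Fin n → ℕ → Set) (F₀ : Fin n → ℕ → ℕ) k j p q {m} →
    (∀ i ℓ t → ℓ ≤ m → ℓ ∸ F₀ i ℓ < t → t ≤ ℓ → Tight i t) →
    p < j → (∀ t → p < t → t < j → Tight k t) → Tight k j → (∀ t → j < t → t < q → Tight k t) →
    ∀ i ℓ t → ℓ ≤ m → ℓ ∸ (if does (i Fin.≟ k) ∧ ((j ≤ᵇ ℓ) ∧ (ℓ <ᵇ q)) then ℓ ∸ p else F₀ i ℓ) < t → t ≤ ℓ →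
    Tight i t
  shift-tight Tight F₀ k j p q F₀-tight p<j below-j at-j above-j i ℓ t ℓ≤m
    with i Fin.≟ k | j ≤ᵇ ℓ in j≤ᵇℓ | ℓ <ᵇ q in ℓ<ᵇq
  ... | no _     | _     | _     = F₀-tight i ℓ t ℓ≤m
  ... | yes refl | false | _     = F₀-tight i ℓ t ℓ≤m
  ... | yes refl | true  | false = F₀-tight i ℓ t ℓ≤m
  ... | yes refl | true  | true  = λ ℓ∸[ℓ∸p]<t t≤ℓ →
    block (subst (_< t) (m∸[m∸n]≡n (≤-trans (<⇒≤ p<j) j≤ℓ)) ℓ∸[ℓ∸p]<t) t≤ℓ
    where
    j≤ℓ = ≤ᵇ⇒≤ j ℓ (from T-≡ j≤ᵇℓ)
    ℓ<q = <ᵇ⇒< ℓ q (from T-≡ ℓ<ᵇq)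
    -- ℓ now lies in F_k^(ℓ-p), and (p, ℓ] is tight by the choice of p and q.
    block : p < t → t ≤ ℓ → Tight i t
    block p<t t≤ℓ with <-cmp t j
    ... | tri< t<j _ _  = below-j t p<t t<j
    ... | tri≈ _ refl _ = at-j
    ... | tri> _ _ j<t  = above-j t j<t (<-≤-trans (s≤s t≤ℓ) ℓ<q)

  DualFeasible : State I → ℚ → Set
  DualFeasible s δ = ∀ i j → 1 ≤ j → j ≤ m → fin (newLoad I s δ i j) ≤∞ g I i j

  load≤newLoad : ∀ s {δ} → 0ℚ ℚ.≤ δ → ∀ i j → load s i j ℚ.≤ newLoad I s δ i j
  load≤newLoad s δ≥0 i j = ≤-if-+ (a s i <ᵇ j) (ℕtoℚ*-nonNeg (τ I i j (a s) (F s)) δ≥0)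

  Full-newLoad : ∀ s {δ} → 0ℚ ℚ.≤ δ → DualFeasible s δ → ∀ i t → 1 ≤ t → t ≤ m →
                 Full I (load s) i t → Full I (newLoad I s δ) i t
  Full-newLoad s δ≥0 feasible i t 1≤t t≤m full =
    tight-stays-tight full (load≤newLoad s δ≥0 i t) (feasible i t 1≤t t≤m)

  step-Full : ∀ {s δ s′} → Step I s δ s′ → ∀ i t → 1 ≤ t → t ≤ m →
              Full I (load s) i t → Full I (load s′) i t
  step-Full {s} (absorb _ _ _ δ≥0 _ _ _ _ feasible _ _ _ _ _ _)         = Full-newLoad s δ≥0 feasible
  step-Full {s} (shift _ _ _ _ δ≥0 _ _ _ _ feasible _ _ _ _ _ _ _ _ _ _) = Full-newLoad s δ≥0 feasible

  step-a-mono : ∀ {s δ s′} → Step I s δ s′ → ∀ i → a s i ≤ a s′ i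
  step-a-mono {s} (absorb k _ q _ _ _ a<j _ _ _ _ j≤q _ _ _) =
    update-elim (λ i v → a s i ≤ v) (a s) k q (<⇒≤ (<-≤-trans a<j j≤q)) (λ _ _ → ≤-refl)
  step-a-mono (shift _ _ _ _ _ _ _ _ _ _ _ _ _ _ _ _ _ _ _ _) _ = ≤-refl

  step-a-agrees-except : ∀ {s δ s′} → Step I s δ s′ → Σ (Fin n) λ k → ∀ i → ¬ i ≡ k → a s′ i ≡ a s i
  step-a-agrees-except {s} (absorb k _ q _ _ _ _ _ _ _ _ _ _ _ _) =
    k , update-elim (λ i v → ¬ i ≡ k → v ≡ a s i) (a s) k q (λ k≢k → ⊥-elim (k≢k refl)) (λ _ _ _ → refl)
  step-a-agrees-except (shift k _ _ _ _ _ _ _ _ _ _ _ _ _ _ _ _ _ _ _) = k , λ _ _ → refl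

  step-next-not-Full : ∀ {s δ s′} → Step I s δ s′ → ∀ i → a s i < a s′ i → a s′ i < m →
                       ¬ Full I (load s′) i (suc (a s′ i))
  step-next-not-Full {s} {δ} (absorb k _ q _ _ _ _ _ _ _ _ _ _ _ q-maximal) =
    update-elim (λ i v → a s i < v → v < m → ¬ Full I (newLoad I s δ) i (suc v)) (a s) k q
      (λ _ q<m → [ (λ q≡m → ⊥-elim (<-irrefl q≡m q<m)) , proj₂ ]′ q-maximal)
      (λ _ _ a<a → ⊥-elim (<-irrefl refl a<a))
  step-next-not-Full (shift _ _ _ _ _ _ _ _ _ _ _ _ _ _ _ _ _ _ _ _) _ a<a _ = ⊥-elim (<-irrefl refl a<a)

  record Invariant (s : State I) : Set where
    field
      z≤1       : ∀ i j → z s i j ≤ 1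
      z-above-a : ∀ i j → a s i < j → z s i j ≡ 0
      -- ℓ ∈ F_i^k makes the k constraints (i, ℓ-k+1), …, (i, ℓ) tight.
      F-tight   : ∀ i ℓ t → ℓ ≤ m → ℓ ∸ F s i ℓ < t → t ≤ ℓ → Full I (load s) i t
  open Invariant

  initial-Invariant : Invariant (initState I)
  initial-Invariant .z≤1 _ _ = z≤n
  initial-Invariant .z-above-a _ _ _ = refl
  initial-Invariant .F-tight _ ℓ _ _ ℓ<t t≤ℓ = ⊥-elim (<-irrefl refl (<-≤-trans ℓ<t t≤ℓ))

  F-tight-newLoad : ∀ s {δ} → Invariant s → 0ℚ ℚ.≤ δ → DualFeasible s δ →
                    ∀ i ℓ t → ℓ ≤ m → ℓ ∸ F s i ℓ < t → t ≤ ℓ → Full I (newLoad I s δ) i t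
  F-tight-newLoad s inv δ≥0 feasible i ℓ t ℓ≤m ℓ∸F<t t≤ℓ =
    Full-newLoad s δ≥0 feasible i t (≤-trans z<s ℓ∸F<t) (≤-trans t≤ℓ ℓ≤m) (F-tight inv i ℓ t ℓ≤m ℓ∸F<t t≤ℓ)

  step-Invariant : ∀ {s δ s′} → Invariant s → Step I s δ s′ → Invariant s′
  step-Invariant {s} inv (absorb k j q δ≥0 _ _ a<j _ feasible _ _ j≤q _ _ _) = record
    { z≤1       = λ i ℓ → if-≤-1 _ (z≤1 inv i ℓ)
    ; z-above-a = absorb-z-above-a (a s) (z s) k j q (z-above-a inv) a<j j≤q
    ; F-tight   = F-tight-newLoad s inv δ≥0 feasible
    }
  step-Invariant {s} {δ} inv
    (shift k j p q δ≥0 _ _ _ _ feasible j-Full _ _ p<j _ p<·<j-Full _ _ j<·<q-Full _) = record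
    { z≤1       = z≤1 inv
    ; z-above-a = z-above-a inv
    ; F-tight   = shift-tight (Full I (newLoad I s δ)) (F s) k j p q
                    (F-tight-newLoad s inv δ≥0 feasible) p<j p<·<j-Full j-Full j<·<q-Full
    }

  exec-Invariant : ∀ {s sf hist} → Invariant s → Exec I s sf hist → Invariant sf
  exec-Invariant inv (done _)        = inv
  exec-Invariant inv (step _ st ex) = exec-Invariant (step-Invariant inv st) ex

  exec-a-mono : ∀ {s sf hist} → Exec I s sf hist → ∀ i → a s i ≤ a sf i
  exec-a-mono (done _)        i = ≤-refl
  exec-a-mono (step _ st ex) i = ≤-trans (step-a-mono st i) (exec-a-mono ex i)

  NextNotFull : State I → State I → Set
  NextNotFull s sf = ∀ i → a s i < a sf i → a sf i < m → ¬ Full I (load s) i (suc (a sf i))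

  exec-next-not-Full : ∀ {s sf hist} → Exec I s sf hist → NextNotFull s sf
  exec-next-not-Full (done _) i a<a _ = ⊥-elim (<-irrefl refl a<a)
  exec-next-not-Full {s} {sf} (step {s' = s′} _ st ex) i a<af af<m full =
    not-Full-at-s′ (step-Full st i (suc (a sf i)) (s≤s z≤n) af<m full)
    where
    not-Full-at-s′ : ¬ Full I (load s′) i (suc (a sf i))
    not-Full-at-s′ with a s′ i <? a sf i
    ... | yes a′<af = exec-next-not-Full ex i a′<af af<m
    ... | no  a′≮af rewrite sym (≤-antisym (exec-a-mono ex i) (≮⇒≥ a′≮af)) =
      step-next-not-Full st i a<af af<m

  record FinalIteration (s sf : State I) : Set where
    field
      before       : Fin n → ℕ
      before-short : sumFin before < D
      a≤before     : ∀ i → a s i ≤ before i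
      changed      : Fin n
      unchanged    : ∀ i → ¬ i ≡ changed → before i ≡ a sf i

  exec-FinalIteration : ∀ {s sf h hist} → Exec I s sf (h ∷ hist) → FinalIteration s sf
  exec-FinalIteration {s} (step D>0 st (done _)) = record
    { before       = a s
    ; before-short = m∸n≢0⇒n<m (λ D∸a≡0 → <-irrefl (sym D∸a≡0) D>0)
    ; a≤before     = λ _ → ≤-refl
    ; changed      = proj₁ (step-a-agrees-except st)
    ; unchanged    = λ i i≢k → sym (proj₂ (step-a-agrees-except st) i i≢k)
    }
  exec-FinalIteration (step _ st ex@(step _ _ _)) = record
    { before       = before
    ; before-short = before-short
    ; a≤before     = λ i → ≤-trans (step-a-mono st i) (a≤before i)
    ; changed      = changed
    ; unchanged    = unchanged
    }
    where open FinalIteration (exec-FinalIteration ex)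

  rowSum : State I → State I → Fin n → ℕ
  rowSum s sf i = sumRange (suc (a s i)) m (λ j → τ I i j (a s) (F s) * z sf i j)

  module RowBound (s sf : State I) (inv-s : Invariant s) (inv-sf : Invariant sf)
                  (next-not-Full : NextNotFull s sf) (i : Fin n) where

    A X H : ℕ
    A = a s i
    X = a sf i
    H = mi I (a s) i

    counted : ℕ → ℕ → ℕ
    counted j ℓ = if (A <ᵇ ℓ) ∧ (F s i ℓ ≡ᵇ (ℓ ∸ j)) then 1 else 0

    τ-as-Σ< : ∀ j → τ I i j (a s) (F s) ≡ Σ< (suc H) (startAt j (counted j))
    τ-as-Σ< j = trans (length-filterᵇ _ (interval j H)) (sumRange-Σ< j H (counted j))

    counted-≤-1 : ∀ {j ℓ} → counted j ℓ ≤ 1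
    counted-≤-1 {j} {ℓ} = if-≤-1 ((A <ᵇ ℓ) ∧ (F s i ℓ ≡ᵇ (ℓ ∸ j))) z≤n

    contrib : ℕ → ℕ → ℕ
    contrib j ℓ = startAt (suc A) (λ j → startAt j (counted j) ℓ * z sf i j) j

    rowSum-swap : rowSum s sf i ≡ Σ< (suc H) (λ ℓ → Σ< (suc m) (λ j → contrib j ℓ))
    rowSum-swap = begin
      rowSum s sf i                                                         ≡⟨ sumRange-Σ< (suc A) m _ ⟩
      Σ< (suc m) (startAt (suc A) (λ j → τ I i j (a s) (F s) * z sf i j))  ≡⟨ Σ<-cong (suc m) (λ j _ → expand j) ⟩
      Σ< (suc m) (λ j → Σ< (suc H) (contrib j))                            ≡⟨ Σ<-swap contrib (suc m) (suc H) ⟩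
      Σ< (suc H) (λ ℓ → Σ< (suc m) (λ j → contrib j ℓ))                    ∎
      where
      open ≡-Reasoning
      expand : ∀ j → startAt (suc A) (λ j → τ I i j (a s) (F s) * z sf i j) j ≡ Σ< (suc H) (contrib j)
      expand j = trans
        (cong (λ x → if suc A ≤ᵇ j then x else 0)
              (trans (cong (_* z sf i j) (τ-as-Σ< j)) (Σ<-*ʳ (startAt j (counted j)) (z sf i j) (suc H))))
        (startAt-Σ< (suc A) (λ j ℓ → startAt j (counted j) ℓ * z sf i j) (suc H) j)

    contrib-pos : ∀ j ℓ → 0 < contrib j ℓ → A < j × j ≤ ℓ × ℓ ∸ F s i ℓ ≡ j × 0 < z sf i j
    contrib-pos j ℓ pos = A<j , j≤ℓ , trans (cong (ℓ ∸_) F≡ℓ∸j) (m∸[m∸n]≡n j≤ℓ) , proj₂ factors-pos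
      where
      outer-pos : suc A ≤ j × 0 < startAt j (counted j) ℓ * z sf i j
      outer-pos = startAt-pos (suc A) (λ j → startAt j (counted j) ℓ * z sf i j) j pos
      A<j : A < j
      A<j = proj₁ outer-pos
      factors-pos : 0 < startAt j (counted j) ℓ × 0 < z sf i j
      factors-pos = *-pos (startAt j (counted j) ℓ) (z sf i j) (proj₂ outer-pos)
      inner-pos : j ≤ ℓ × 0 < counted j ℓ
      inner-pos = startAt-pos j (counted j) ℓ (proj₁ factors-pos)
      j≤ℓ : j ≤ ℓ
      j≤ℓ = proj₁ inner-pos
      F≡ℓ∸j : F s i ℓ ≡ ℓ ∸ j
      F≡ℓ∸j = ≡ᵇ⇒≡ (F s i ℓ) (ℓ ∸ j) (proj₂ (to T-∧ (if-pos ((A <ᵇ ℓ) ∧ (F s i ℓ ≡ᵇ (ℓ ∸ j))) (proj₂ inner-pos))))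

    contrib-≤-z : ∀ j ℓ → contrib j ℓ ≤ z sf i j
    contrib-≤-z j ℓ = begin
      contrib j ℓ                         ≤⟨ startAt-≤ (suc A) (λ j → startAt j (counted j) ℓ * z sf i j) j ⟩
      startAt j (counted j) ℓ * z sf i j  ≤⟨ *-monoˡ-≤ (z sf i j) (≤-trans (startAt-≤ j (counted j) ℓ) (counted-≤-1 {j})) ⟩
      1 * z sf i j                        ≡⟨ *-identityˡ (z sf i j) ⟩
      z sf i j                            ∎
      where open ≤-Reasoning

    -- Otherwise the block of tight constraints ending at ℓ would contain (i, X + 1).
    contrib-support-≤-X : ∀ j ℓ → ℓ ≤ m → 0 < contrib j ℓ → ℓ ≤ X
    contrib-support-≤-X j ℓ ℓ≤m pos with ℓ ≤? X | contrib-pos j ℓ pos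
    ... | yes ℓ≤X | _ = ℓ≤X
    ... | no  ℓ≰X | A<j , _ , ℓ∸F≡j , z-pos =
      ⊥-elim (next-not-Full i (<-≤-trans A<j j≤X) (<-≤-trans X<ℓ ℓ≤m)
               (F-tight inv-s i ℓ (suc X) ℓ≤m (subst (_< suc X) (sym ℓ∸F≡j) (s≤s j≤X)) X<ℓ))
      where
      X<ℓ = ≰⇒> ℓ≰X
      j≤X = ≮⇒≥ (λ X<j → <-irrefl (sym (z-above-a inv-sf i j X<j)) z-pos)

    upToX : ℕ → ℕ
    upToX ℓ = if ℓ ≤ᵇ X then 1 else 0

    window : ℕ → ℕ
    window = startAt (suc A) upToX

    window-≤-1 : ∀ ℓ → window ℓ ≤ 1
    window-≤-1 ℓ = ≤-trans (startAt-≤ (suc A) upToX ℓ) (if-≤-1 (ℓ ≤ᵇ X) z≤n)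

    window-pos : ∀ ℓ → 0 < window ℓ → suc A ≤ ℓ × ℓ ≤ X
    window-pos ℓ pos with startAt-pos (suc A) upToX ℓ pos
    ... | A<ℓ , upToX-pos = A<ℓ , ≤ᵇ⇒≤ ℓ X (if-pos (ℓ ≤ᵇ X) upToX-pos)

    window-≡-1 : ∀ {ℓ} → A < ℓ → ℓ ≤ X → window ℓ ≡ 1
    window-≡-1 A<ℓ ℓ≤X rewrite startAt-≥ upToX A<ℓ | to T-≡ (≤⇒≤ᵇ ℓ≤X) = refl

    column-≤-window : ∀ ℓ → ℓ ≤ m → Σ< (suc m) (λ j → contrib j ℓ) ≤ window ℓ
    column-≤-window ℓ ℓ≤m = Σ<-≤-single (ℓ ∸ F s i ℓ) (suc m) contrib-≤-window
      (λ j pos → sym (proj₁ (proj₂ (proj₂ (contrib-pos j ℓ pos)))))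
      where
      contrib-≤-window : ∀ j → contrib j ℓ ≤ window ℓ
      contrib-≤-window j = ≤-when-pos λ pos →
        let A<j , j≤ℓ , _ = contrib-pos j ℓ pos in
        subst (contrib j ℓ ≤_) (sym (window-≡-1 (<-≤-trans A<j j≤ℓ) (contrib-support-≤-X j ℓ ℓ≤m pos)))
          (≤-trans (contrib-≤-z j ℓ) (z≤1 inv-sf i j))

    rowSum-≤-window : rowSum s sf i ≤ Σ< (suc H) window
    rowSum-≤-window = subst (_≤ Σ< (suc H) window) (sym rowSum-swap)
      (Σ<-mono-≤ (suc H) (λ ℓ ℓ≤H → column-≤-window ℓ (≤-trans (s≤s⁻¹ ℓ≤H) (m⊓n≤m m _))))

    rowSum-≤-increase : rowSum s sf i ≤ X ∸ A
    rowSum-≤-increase = ≤-trans rowSum-≤-window (Σ<-≤-range (suc H) window-≤-1 window-pos)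

    rowSum-≤-Dres : rowSum s sf i ≤ Dres I (a s)
    rowSum-≤-Dres = begin
      rowSum s sf i                    ≤⟨ rowSum-≤-window ⟩
      Σ< (suc H) window                ≤⟨ Σ<-≤-∸ (suc H) window-≤-1 (λ ℓ pos → proj₁ (window-pos ℓ pos)) ⟩
      H ∸ A                            ≤⟨ ∸-monoˡ-≤ A (m⊓n≤n m (A + Dres I (a s))) ⟩
      A + Dres I (a s) ∸ A             ≡⟨ m+n∸m≡n A (Dres I (a s)) ⟩
      Dres I (a s)                     ∎
      where open ≤-Reasoning

  cover-bound : ∀ {s sf} → Invariant s → Invariant sf → NextNotFull s sf → FinalIteration s sf →
                sumFin (rowSum s sf) ≤ 2 * Dres I (a s)
  cover-bound {s} {sf} inv-s inv-sf next-not-Full last = begin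
    sumFin (rowSum s sf)                   ≤⟨ sumFin-≤-except (rowSum s sf) increase changed unchanged-rowSum-≤-increase ⟩
    sumFin increase + rowSum s sf changed  ≤⟨ +-mono-≤ increase-≤-Dres (rowSum-≤-Dres changed) ⟩
    Dres I (a s) + Dres I (a s)            ≡⟨ cong (Dres I (a s) +_) (+-identityʳ (Dres I (a s))) ⟨
    2 * Dres I (a s)                       ∎
    where
    open ≤-Reasoning
    open FinalIteration last
    open RowBound s sf inv-s inv-sf next-not-Full
    increase : Fin n → ℕ
    increase i = before i ∸ a s i
    unchanged-rowSum-≤-increase : ∀ i → ¬ i ≡ changed → rowSum s sf i ≤ increase i
    unchanged-rowSum-≤-increase i i≢k = subst (λ x → rowSum s sf i ≤ x ∸ a s i) (sym (unchanged i i≢k)) (rowSum-≤-increase i)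
    increase-≤-Dres : sumFin increase ≤ Dres I (a s)
    increase-≤-Dres = begin
      sumFin increase               ≡⟨ sumFin-∸ (a s) before a≤before ⟩
      sumFin before ∸ sumFin (a s)  ≤⟨ ∸-monoˡ-≤ (sumFin (a s)) (<⇒≤ before-short) ⟩
      D ∸ sumFin (a s)              ∎

  history-bound : ∀ {s₀ sf hist} → Invariant s₀ → Exec I s₀ sf hist → ∀ s δ → (s , δ) ∈ hist →
                  sumFin (rowSum s sf) ≤ 2 * Dres I (a s)
  history-bound inv (done _)          s δ ()
  history-bound inv ex@(step _ _ _)   s δ (here refl) =
    cover-bound inv (exec-Invariant inv ex) (exec-next-not-Full ex) (exec-FinalIteration ex)
  history-bound inv (step _ st ex)    s δ (there mem) = history-bound (step-Invariant inv st) ex s δ mem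

open import Data.Nat using (ℕ; suc; _≤_; _*_)
open import Data.Rational using (ℚ; 0ℚ; _<_)
open import Data.List using (List)
open import Data.List.Membership.Propositional using (_∈_)
open import Data.Product using (_×_; _,_)

lemma1 : (I : Instance) (sf : State I) (hist : List (State I × ℚ)) →
    Exec I (initState I) sf hist →
    ∀ (s : State I) (δ : ℚ) → (s , δ) ∈ hist → 0ℚ < δ →
    sumFin (λ i → sumRange (suc (a s i)) (Instance.m I)
                    (λ j → τ I i j (a s) (F s) * z sf i j))
      ≤ 2 * Dres I (a s)
-- The bound holds for every visited (a, F), whether or not v_aF > 0.
lemma1 I sf hist ex s δ mem _ = history-bound initial-Invariant ex s δ mem
  where open Algorithm1 I
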